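{- Let $\langle S,\to\rangle$ be a parallel transaction system over a finite thread set $\mathcal T$ with error sets $\mathcal W_i$ (as in the context), let $T\subseteq\mathcal T$ and $\to_T=\bigcup_{i\in T}\to_i$. If $p\to_T^{*}q$ with $p\in\mathcal N_T$ and $q\in\mathcal W_i$ for some thread $i$, then there exists an ots $p\to^{*}q'$ under $T$ with $q'\cong q$ and $q'\in\mathcal W_i$.
   Context: Notation: for $X\subseteq S$, $Q\subseteq S\times S$: $X\lhd Q=Q\cap(X\times S)$, $Q\rhd X=Q\cap(S\times X)$, $\overline X=S\setminus X$; for $X\subseteq\mathcal T$, $\mathcal N_X=\bigcap_{i\in X}\mathcal N_i$. A transition system over $\mathcal T$ is $\langle S,\to\rangle$ with $\to=\bigcup_{i\in\mathcal T}\to_i$. A thread bisimulation is an equivalence $R$ on $S$ such that $(\sigma,\sigma')\in R$ and $\sigma\to_i\sigma_1$ imply $\sigma'\to_i\sigma_1'$ for some $\sigma_1'$ with $(\sigma_1,\sigma_1')\in R$. For $A,B\subseteq S\times S$ and equivalence $R$: $A$ right-commutes with $B$ up to $R$ iff whenever $(\sigma_1,\sigma_2)\in A,(\sigma_2,\sigma_3)\in B$ there are $\sigma_4,\sigma_3'$ with $(\sigma_1,\sigma_4)\in B,(\sigma_4,\sigma_3')\in A,(\sigma_3,\sigma_3')\in R$; $A$ left-commutes with $B$ up to $R$ iff whenever $(\sigma_1,\sigma_2)\in B,(\sigma_2,\sigma_3)\in A$ there are $\sigma_4,\sigma_3'$ with $(\sigma_1,\sigma_4)\in A,(\sigma_4,\sigma_3')\in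 B,(\sigma_3,\sigma_3')\in R$. Phase-annotated system: for each $i$ sets $\mathcal R_i,\mathcal L_i,\mathcal N_i$ and a thread bisimulation $\cong_i$ with, for all $i$, $j\ne i$: $S=\mathcal R_i\uplus\mathcal L_i\uplus\mathcal N_i$; $\to_i\cap\to_j=\emptyset$; $\to_i\subseteq\mathcal L_j^2\cup\mathcal R_j^2\cup\mathcal N_j^2$; $\cong_i\subseteq\mathcal L_j^2\cup\mathcal R_j^2\cup\mathcal N_j^2$. For $X\subseteq\mathcal T$, $\cong_X=(\bigcup_{i\in X}\cong_i)^*$, $\cong=\cong_{\mathcal T}$. Parallel transaction system: additionally for all $i$, $j\ne i$: $\mathcal L_i\lhd\to_i\rhd\mathcal R_i=\emptyset$; $\to_i\rhd\mathcal R_i$ right-commutes with $\to_j$ up to $\cong_{\{j\}}$; $\mathcal L_i\lhd\to_i$ left-commutes with $\to_j$ up to $\cong_{\{i,j\}}$; every $\sigma\in\mathcal L_i$ has some $\sigma'\in\mathcal N_i$ with $\sigma\to_i^{+}\sigma'$. Error states: sets $\mathcal W_i$ with, for all $i$, $j\ne i$ and all $k$: $\mathcal W_i\subseteq\mathcal N_i$; $\mathcal W_i\lhd\to_i\rhd\overline{\mathcal W_i}=\emptyset$; $\to_i\subseteq\mathcal W_j^2\cup\overline{\mathcal W_j}^2$; $\cong_i\subseteq\mathcal W_k^2\cup\overline{\mathcal W_k}^2$. A uts under $T'$ is a path $q_1\to_{\psi(1)}^{+}q_2\cdots\to_{\psi(l)}^{+}q_{l+1}$ ($l\ge0$) whose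 blocks are $q_k=q_{k,1}\to_{\psi(k)}\cdots\to_{\psi(k)}q_{k,x_k}=q_{k+1}$ with $\psi(k)\in T'$, $q_1\in\mathcal N_{T'}$, $q_{k,1}\in\mathcal N_{\psi(k)}$, $q_{k,2},\dots,q_{k,x_k}\in\mathcal R_{\psi(k)}$. A cts under $T'$ is a path $p_1\to_{\varphi(1)}^{+}p_2\cdots\to_{\varphi(k)}^{+}p_{k+1}$ ($k\ge0$) whose blocks are $p_m=p_{m,1}\to_{\varphi(m)}\cdots\to_{\varphi(m)}p_{m,x_m}=p_{m+1}$ with $\varphi(m)\in T'$, $p_1\in\mathcal N_{T'}$, $p_{m,1}\in\mathcal N_{\varphi(m)}$, $p_{m,2},\dots,p_{m,x_m-1}\in\mathcal R_{\varphi(m)}\cup\mathcal L_{\varphi(m)}$, $p_{m,x_m}\in\mathcal L_{\varphi(m)}\cup\mathcal N_{\varphi(m)}$. If $A$ is a cts under $T_A$ and $B$ a uts under $T_B$ starting in the last state of $A$, the concatenation $AB$ is an ots under $T_A\cup T_B$. -}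

module Defs where

open import Level using (0ℓ)
open import Data.Nat using (ℕ)
open import Data.Fin using (Fin)
open import Data.Fin.Subset using (Subset; _∈_; _∪_; ⁅_⁆; ⊤)
open import Data.Product using (Σ; ∃; ∃₂; _×_; _,_)
open import Data.Sum using (_⊎_)
open import Data.Empty using (⊥)
open import Relation.Nullary using (¬_)
open import Relation.Unary using (Pred)
open import Relation.Binary.Core using (Rel)
open import Relation.Binary.Structures using (IsEquivalence)
open import Relation.Binary.PropositionalEquality using (_≡_; _≢_)
open import Relation.Binary.Construct.Closure.ReflexiveTransitive using (Star)
open import Relation.Binary.Construct.Closure.Transitive using (TransClosure)

_◁_ : {S : Set} → Pred S 0ℓ → Rel S 0ℓ → Rel S 0ℓ
(X ◁ Q) a b = X a × Q a b

_▷_ : {S : Set} → Rel S 0ℓ → Pred S 0ℓ → Rel S 0ℓ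
(Q ▷ X) a b = Q a b × X b

RightCommutes : {S : Set} → Rel S 0ℓ → Rel S 0ℓ → Rel S 0ℓ → Set
RightCommutes A B R = ∀ {s₁ s₂ s₃} → A s₁ s₂ → B s₂ s₃ →
  ∃₂ λ s₄ s₃′ → B s₁ s₄ × A s₄ s₃′ × R s₃ s₃′

LeftCommutes : {S : Set} → Rel S 0ℓ → Rel S 0ℓ → Rel S 0ℓ → Set
LeftCommutes A B R = ∀ {s₁ s₂ s₃} → B s₁ s₂ → A s₂ s₃ →
  ∃₂ λ s₄ s₃′ → A s₁ s₄ × B s₄ s₃′ × R s₃ s₃′

Within3 : {S : Set} → Pred S 0ℓ → Pred S 0ℓ → Pred S 0ℓ → Rel S 0ℓ → Set
Within3 X Y Z Q = ∀ {a b} → Q a b → (X a × X b) ⊎ (Y a × Y b) ⊎ (Z a × Z b)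

UnionRel : {n : ℕ} {S : Set} → (Fin n → Rel S 0ℓ) → Subset n → Rel S 0ℓ
UnionRel Q X a b = Σ (Fin _) λ i → i ∈ X × Q i a b

record ParallelTransactionSystem (n : ℕ) : Set₁ where
  field
    S     : Set
    step  : Fin n → Rel S 0ℓ
    𝓡 𝓛 𝓝 : Fin n → Pred S 0ℓ
    ≅ᵢ    : Fin n → Rel S 0ℓ

  ≅[_] : Subset n → Rel S 0ℓ
  ≅[ X ] = Star (UnionRel ≅ᵢ X)

  field
    partition   : ∀ i σ → 𝓡 i σ ⊎ 𝓛 i σ ⊎ 𝓝 i σ
    disjRL      : ∀ i σ → 𝓡 i σ → 𝓛 i σ → ⊥
    disjRN      : ∀ i σ → 𝓡 i σ → 𝓝 i σ → ⊥
    disjLN      : ∀ i σ → 𝓛 i σ → 𝓝 i σ → ⊥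
    step-disj   : ∀ i j → i ≢ j → ∀ {a b} → step i a b → step j a b → ⊥
    step-phase  : ∀ i j → i ≢ j → Within3 (𝓛 j) (𝓡 j) (𝓝 j) (step i)
    ≅-phase     : ∀ i j → i ≢ j → Within3 (𝓛 j) (𝓡 j) (𝓝 j) (≅ᵢ i)
    ≅-equiv     : ∀ i → IsEquivalence (≅ᵢ i)
    ≅-bisim     : ∀ i k {σ σ′ σ₁} → ≅ᵢ i σ σ′ → step k σ σ₁ →
                  ∃ λ σ₁′ → step k σ′ σ₁′ × ≅ᵢ i σ₁ σ₁′
    no-L→R      : ∀ i {a b} → (𝓛 i ◁ (step i ▷ 𝓡 i)) a b → ⊥
    right-comm  : ∀ i j → i ≢ j →
                  RightCommutes (step i ▷ 𝓡 i) (step j) ≅[ ⁅ j ⁆ ]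
    left-comm   : ∀ i j → i ≢ j →
                  LeftCommutes (𝓛 i ◁ step i) (step j) ≅[ ⁅ i ⁆ ∪ ⁅ j ⁆ ]
    L-progress  : ∀ i {σ} → 𝓛 i σ → ∃ λ σ′ → 𝓝 i σ′ × TransClosure (step i) σ σ′

  step[_] : Subset n → Rel S 0ℓ
  step[ X ] = UnionRel step X

  _≅_ : Rel S 0ℓ
  _≅_ = ≅[ ⊤ ]

  𝓝[_] : Subset n → Pred S 0ℓ
  𝓝[ X ] σ = ∀ i → i ∈ X → 𝓝 i σ

  -- uts block of thread i: a = q₁ →ᵢ q₂ →ᵢ … →ᵢ q_x = b, q₂..q_x ∈ 𝓡 i
  data RPath (i : Fin n) : Rel S 0ℓ where
    last : ∀ {a b} → step i a b → 𝓡 i b → RPath i a b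
    more : ∀ {a b c} → step i a b → 𝓡 i b → RPath i b c → RPath i a c

  -- cts block tail of thread i: intermediates in 𝓡 ∪ 𝓛, last in 𝓛 ∪ 𝓝
  data CPath (i : Fin n) : Rel S 0ℓ where
    last : ∀ {a b} → step i a b → 𝓛 i b ⊎ 𝓝 i b → CPath i a b
    more : ∀ {a b c} → step i a b → 𝓡 i b ⊎ 𝓛 i b → CPath i b c → CPath i a c

  data UBlocks (T′ : Subset n) : Rel S 0ℓ where
    []  : ∀ {a} → UBlocks T′ a a
    blk : ∀ {a b c} i → i ∈ T′ → 𝓝 i a → RPath i a b → UBlocks T′ b c → UBlocks T′ a c

  data CBlocks (T′ : Subset n) : Rel S 0ℓ where
    []  : ∀ {a} → CBlocks T′ a a
    blk : ∀ {a b c} i → i ∈ T′ → 𝓝 i a → CPath i a b → CBlocks T′ b c → CBlocks T′ a c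

  UTS : Subset n → Rel S 0ℓ
  UTS T′ a b = 𝓝[ T′ ] a × UBlocks T′ a b

  CTS : Subset n → Rel S 0ℓ
  CTS T′ a b = 𝓝[ T′ ] a × CBlocks T′ a b

  OTS : Subset n → Rel S 0ℓ
  OTS T a b = Σ (Subset n) λ TA → Σ (Subset n) λ TB → (TA ∪ TB) ≡ T ×
              ∃ λ m → CTS TA a m × UTS TB m b

record ErrorStates {n : ℕ} (P : ParallelTransactionSystem n) : Set₁ where
  open ParallelTransactionSystem P
  field
    𝓦         : Fin n → Pred S 0ℓ
    W⊆N       : ∀ i {σ} → 𝓦 i σ → 𝓝 i σ
    W-closed  : ∀ i {a b} → 𝓦 i a → step i a b → ¬ 𝓦 i b → ⊥
    step-W    : ∀ i j → i ≢ j → ∀ {a b} → step i a b →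
                (𝓦 j a × 𝓦 j b) ⊎ (¬ 𝓦 j a × ¬ 𝓦 j b)
    ≅-W       : ∀ i k {a b} → ≅ᵢ i a b →
                (𝓦 k a × 𝓦 k b) ⊎ (¬ 𝓦 k a × ¬ 𝓦 k b)

-- Rebuild an arbitrary T-path from p, one step at a time, into an ots (a cts
-- followed by a uts) ending in a state ≅ to the end of the path read so far.
-- A new step of thread k is placed according to the phase of k at the seam
-- between the cts and the uts.  If k is in 𝓝 there, the step is commuted to
-- the left past the uts blocks of the other threads (they are right movers),
-- and the resulting k-path is cut into cts and uts blocks of k.  If k is in 𝓛,
-- it is inside its last cts block; the step is a left mover, so it commutes
-- back to the end of that block, and everything after the block, now without
-- k and strictly shorter than the path read so far, is rebuilt recursively.
-- Phase 𝓡 cannot occur at the seam.  Finally ≅ respects error states, so the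
-- ots ends in 𝓦 i whenever q does.
module Submission where

open import Defs
open import Level using (0ℓ)
open import Data.Nat using (ℕ; zero; suc; _+_; _<_; _≤_; s≤s)
open import Data.Nat.Properties
  using (+-identityʳ; +-assoc; +-commutativeSemigroup; ≤-refl; ≤-trans; m≤n+m; +-monoˡ-≤)
open import Data.Nat.Induction using (<-rec)
open import Data.Nat.Tactic.RingSolver using (solve-∀)
open import Algebra.Properties.CommutativeSemigroup +-commutativeSemigroup using (x∙yz≈y∙xz)
open import Data.Fin using (Fin; _≟_)
open import Data.Fin.Subset using (Subset; _∈_; _∪_; _∩_; ⁅_⁆; ⊤; ⊥)
open import Data.Fin.Subset.Properties
  using (∈⊤; x∈⁅x⁆; x∈⁅y⁆⇒x≡y; x∈p∪q⁻; x∈p∪q⁺; x∈p∩q⁺; x∈p∩q⁻; ∪-abs-∩; ∉⊥)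
open import Data.Product using (∃; ∃₂; Σ; _×_; _,_; proj₂; map₁)
open import Data.Sum using (_⊎_; inj₁; inj₂)
open import Data.Empty using (⊥-elim)
open import Data.Unit using (tt) renaming (⊤ to Unit)
open import Relation.Nullary using (¬_; yes; no)
open import Relation.Binary.Core using (Rel)
open import Relation.Binary.Structures using (IsEquivalence)
open import Relation.Binary.PropositionalEquality
  using (_≡_; _≢_; refl; sym; trans; cong; cong₂; subst; ≢-sym; module ≡-Reasoning)
open import Relation.Binary.Construct.Closure.ReflexiveTransitive
  using (Star; ε; _◅_; _◅◅_; reverse) renaming (map to Star-map)

module Reordering {n : ℕ} (P : ParallelTransactionSystem n) (T : Subset n) where
  open ParallelTransactionSystem P

  record SamePhase (j : Fin n) (a b : S) : Set where
    field
      R→ : 𝓡 j a → 𝓡 j b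
      R← : 𝓡 j b → 𝓡 j a
      L→ : 𝓛 j a → 𝓛 j b
      L← : 𝓛 j b → 𝓛 j a
      N→ : 𝓝 j a → 𝓝 j b
      N← : 𝓝 j b → 𝓝 j a
  open SamePhase

  within3⇒samePhase : ∀ {j a b} →
    (𝓛 j a × 𝓛 j b) ⊎ (𝓡 j a × 𝓡 j b) ⊎ (𝓝 j a × 𝓝 j b) → SamePhase j a b
  within3⇒samePhase {j} {a} {b} (inj₁ (La , Lb)) = record
    { R→ = λ Ra → ⊥-elim (disjRL j a Ra La) ; R← = λ Rb → ⊥-elim (disjRL j b Rb Lb)
    ; L→ = λ _ → Lb ; L← = λ _ → La
    ; N→ = λ Na → ⊥-elim (disjLN j a La Na) ; N← = λ Nb → ⊥-elim (disjLN j b Lb Nb) }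
  within3⇒samePhase {j} {a} {b} (inj₂ (inj₁ (Ra , Rb))) = record
    { R→ = λ _ → Rb ; R← = λ _ → Ra
    ; L→ = λ La → ⊥-elim (disjRL j a Ra La) ; L← = λ Lb → ⊥-elim (disjRL j b Rb Lb)
    ; N→ = λ Na → ⊥-elim (disjRN j a Ra Na) ; N← = λ Nb → ⊥-elim (disjRN j b Rb Nb) }
  within3⇒samePhase {j} {a} {b} (inj₂ (inj₂ (Na , Nb))) = record
    { R→ = λ Ra → ⊥-elim (disjRN j a Ra Na) ; R← = λ Rb → ⊥-elim (disjRN j b Rb Nb)
    ; L→ = λ La → ⊥-elim (disjLN j a La Na) ; L← = λ Lb → ⊥-elim (disjLN j b Lb Nb)
    ; N→ = λ _ → Nb ; N← = λ _ → Na }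

  samePhase-refl : ∀ {j a} → SamePhase j a a
  samePhase-refl = record
    { R→ = λ x → x ; R← = λ x → x ; L→ = λ x → x ; L← = λ x → x ; N→ = λ x → x ; N← = λ x → x }

  samePhase-trans : ∀ {j a b c} → SamePhase j a b → SamePhase j b c → SamePhase j a c
  samePhase-trans ab bc = record
    { R→ = λ x → R→ bc (R→ ab x) ; R← = λ x → R← ab (R← bc x)
    ; L→ = λ x → L→ bc (L→ ab x) ; L← = λ x → L← ab (L← bc x)
    ; N→ = λ x → N→ bc (N→ ab x) ; N← = λ x → N← ab (N← bc x) }

  step⇒samePhase : ∀ {i j a b} → i ≢ j → step i a b → SamePhase j a b
  step⇒samePhase {i} {j} i≢j s = within3⇒samePhase (step-phase i j i≢j s)

  ≅ᵢ⇒samePhase : ∀ {i j a b} → i ≢ j → ≅ᵢ i a b → SamePhase j a b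
  ≅ᵢ⇒samePhase {i} {j} i≢j r = within3⇒samePhase (≅-phase i j i≢j r)

  ≅⁅⁆⇒samePhase : ∀ {k j a b} → k ≢ j → ≅[ ⁅ k ⁆ ] a b → SamePhase j a b
  ≅⁅⁆⇒samePhase k≢j ε = samePhase-refl
  ≅⁅⁆⇒samePhase {k} k≢j ((i , i∈k , r) ◅ rs) =
    samePhase-trans (≅ᵢ⇒samePhase i≢j r) (≅⁅⁆⇒samePhase k≢j rs)
    where
    i≢j = λ i≡j → k≢j (trans (sym (x∈⁅y⁆⇒x≡y k i∈k)) i≡j)

  ≅[]⇒≅ : ∀ {X a b} → ≅[ X ] a b → a ≅ b
  ≅[]⇒≅ = Star-map λ { (i , _ , r) → i , ∈⊤ , r }

  ≅[]-sym : ∀ {X a b} → ≅[ X ] a b → ≅[ X ] b a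
  ≅[]-sym = reverse λ { (i , i∈X , r) → i , i∈X , IsEquivalence.sym (≅-equiv i) r }

  simulate-step : ∀ {X a a′ b k} → ≅[ X ] a a′ → step k a b →
    ∃ λ b′ → step k a′ b′ × ≅[ X ] b b′
  simulate-step ε s = _ , s , ε
  simulate-step {k = k} ((i , i∈X , r) ◅ rs) s with ≅-bisim i k r s
  ... | _ , s₁ , r₁ with simulate-step rs s₁
  ... | _ , s₂ , rs₂ = _ , s₂ , (i , i∈X , r₁) ◅ rs₂

  data Path (Q : Fin n → Set) : ℕ → Rel S 0ℓ where
    []   : ∀ {a} → Path Q 0 a a
    cons : ∀ {a b c l} i → Q i → step i a b → Path Q l b c → Path Q (suc l) a c

  ThreadPath : Fin n → ℕ → Rel S 0ℓ
  ThreadPath k = Path (_≡ k)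

  _++_ : ∀ {Q l₁ l₂ a b c} → Path Q l₁ a b → Path Q l₂ b c → Path Q (l₁ + l₂) a c
  [] ++ π = π
  cons i qi s π ++ π′ = cons i qi s (π ++ π′)

  Path-map : ∀ {Q Q′ l a b} → (∀ i → Q i → Q′ i) → Path Q l a b → Path Q′ l a b
  Path-map f [] = []
  Path-map f (cons i qi s π) = cons i (f i qi) s (Path-map f π)

  simulate-path : ∀ {X Q l a a′ b} → ≅[ X ] a a′ → Path Q l a b →
    ∃ λ b′ → Path Q l a′ b′ × ≅[ X ] b b′
  simulate-path r [] = _ , [] , r
  simulate-path r (cons i qi s π) with simulate-step r s
  ... | _ , s′ , r′ with simulate-path r′ π
  ... | _ , π′ , r″ = _ , cons i qi s′ π′ , r″

  path⇒samePhase : ∀ {Q j l a b} → (∀ i → Q i → i ≢ j) → Path Q l a b → SamePhase j a b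
  path⇒samePhase ≢j [] = samePhase-refl
  path⇒samePhase ≢j (cons i qi s π) =
    samePhase-trans (step⇒samePhase (≢j i qi) s) (path⇒samePhase ≢j π)

  threadPath⇒samePhase : ∀ {k j l a b} → k ≢ j → ThreadPath k l a b → SamePhase j a b
  threadPath⇒samePhase k≢j = path⇒samePhase λ { _ refl → k≢j }

  unsnoc : ∀ {Q l a c} → Path Q (suc l) a c →
    ∃ λ b → Path Q l a b × ∃ λ i → Q i × step i b c
  unsnoc (cons i qi s []) = _ , [] , i , qi , s
  unsnoc (cons i qi s π@(cons _ _ _ _)) with unsnoc π
  ... | _ , π′ , final = _ , cons i qi s π′ , final

  rpLength : ∀ {j a b} → RPath j a b → ℕ
  rpLength (last _ _) = 1
  rpLength (more _ _ B) = suc (rpLength B)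

  cpLength : ∀ {j a b} → CPath j a b → ℕ
  cpLength (last _ _) = 1
  cpLength (more _ _ B) = suc (cpLength B)

  ubLength : ∀ {X a b} → UBlocks X a b → ℕ
  ubLength [] = 0
  ubLength (blk _ _ _ B U) = rpLength B + ubLength U

  cbLength : ∀ {X a b} → CBlocks X a b → ℕ
  cbLength [] = 0
  cbLength (blk _ _ _ B C) = cpLength B + cbLength C

  _++ᶜ_ : ∀ {X a b c} → CBlocks X a b → CBlocks X b c → CBlocks X a c
  [] ++ᶜ D = D
  blk i i∈X Ni B C ++ᶜ D = blk i i∈X Ni B (C ++ᶜ D)

  cbLength-++ : ∀ {X a b c} (C : CBlocks X a b) (D : CBlocks X b c) →
    cbLength (C ++ᶜ D) ≡ cbLength C + cbLength D
  cbLength-++ [] D = refl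
  cbLength-++ (blk _ _ _ B C) D =
    trans (cong (cpLength B +_) (cbLength-++ C D))
          (sym (+-assoc (cpLength B) (cbLength C) (cbLength D)))

  _++ᵘ_ : ∀ {X a b c} → UBlocks X a b → UBlocks X b c → UBlocks X a c
  [] ++ᵘ V = V
  blk i i∈X Ni B U ++ᵘ V = blk i i∈X Ni B (U ++ᵘ V)

  ubLength-++ : ∀ {X a b c} (U : UBlocks X a b) (V : UBlocks X b c) →
    ubLength (U ++ᵘ V) ≡ ubLength U + ubLength V
  ubLength-++ [] V = refl
  ubLength-++ (blk _ _ _ B U) V =
    trans (cong (rpLength B +_) (ubLength-++ U V))
          (sym (+-assoc (rpLength B) (ubLength U) (ubLength V)))

  RPath⇒path : ∀ {Q i a b} (B : RPath i a b) → Q i → Path Q (rpLength B) a b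
  RPath⇒path {i = i} (last s _) qi = cons i qi s []
  RPath⇒path {i = i} (more s _ B) qi = cons i qi s (RPath⇒path B qi)

  CPath⇒path : ∀ {Q i a b} (B : CPath i a b) → Q i → Path Q (cpLength B) a b
  CPath⇒path {i = i} (last s _) qi = cons i qi s []
  CPath⇒path {i = i} (more s _ B) qi = cons i qi s (CPath⇒path B qi)

  RPath⇒samePhase : ∀ {i j a b} → i ≢ j → RPath i a b → SamePhase j a b
  RPath⇒samePhase {i} i≢j B = path⇒samePhase (λ { _ refl → i≢j }) (RPath⇒path {_≡ i} B refl)

  CPath⇒samePhase : ∀ {i j a b} → i ≢ j → CPath i a b → SamePhase j a b
  CPath⇒samePhase {i} i≢j B = path⇒samePhase (λ { _ refl → i≢j }) (CPath⇒path {_≡ i} B refl)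

  RPath-end : ∀ {i a b} → RPath i a b → 𝓡 i b
  RPath-end (last _ Rb) = Rb
  RPath-end (more _ _ B) = RPath-end B

  CPath-end : ∀ {i a b} → CPath i a b → 𝓛 i b ⊎ 𝓝 i b
  CPath-end (last _ LNb) = LNb
  CPath-end (more _ _ B) = CPath-end B

  RPath-head : ∀ {i a b} → RPath i a b → ∃ λ b₁ → step i a b₁ × 𝓡 i b₁
  RPath-head (last s Rb) = _ , s , Rb
  RPath-head (more s Rb _) = _ , s , Rb

  CPath-snoc : ∀ {k a b c} → CPath k a b → 𝓛 k b → step k b c → 𝓛 k c ⊎ 𝓝 k c → CPath k a c
  CPath-snoc (last s _) Lb s′ LNc = more s (inj₂ Lb) (last s′ LNc)
  CPath-snoc (more s RLb B) Lb s′ LNc = more s RLb (CPath-snoc B Lb s′ LNc)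

  cpLength-snoc : ∀ {k a b c} (B : CPath k a b) Lb (s : step k b c) LNc →
    cpLength (CPath-snoc B Lb s LNc) ≡ suc (cpLength B)
  cpLength-snoc (last _ _) Lb s LNc = refl
  cpLength-snoc (more _ _ B) Lb s LNc = cong suc (cpLength-snoc B Lb s LNc)

  simulate-RPath : ∀ {j k a a′ b} → k ≢ j → ≅[ ⁅ k ⁆ ] a a′ → (B : RPath j a b) →
    ∃ λ b′ → Σ (RPath j a′ b′) (λ B′ → rpLength B′ ≡ rpLength B) × ≅[ ⁅ k ⁆ ] b b′
  simulate-RPath k≢j r (last s Rb) with simulate-step r s
  ... | _ , s′ , r′ = _ , (last s′ (R→ (≅⁅⁆⇒samePhase k≢j r′) Rb) , refl) , r′
  simulate-RPath k≢j r (more s Rb B) with simulate-step r s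
  ... | _ , s′ , r′ with simulate-RPath k≢j r′ B
  ... | _ , (B′ , eq) , r″ = _ , (more s′ (R→ (≅⁅⁆⇒samePhase k≢j r′) Rb) B′ , cong suc eq) , r″

  NoBlockOf : ∀ {X a b} → Fin n → UBlocks X a b → Set
  NoBlockOf k [] = Unit
  NoBlockOf k (blk i _ _ _ U) = i ≢ k × NoBlockOf k U

  NoBlockOfᶜ : ∀ {X a b} → Fin n → CBlocks X a b → Set
  NoBlockOfᶜ k [] = Unit
  NoBlockOfᶜ k (blk i _ _ _ C) = i ≢ k × NoBlockOfᶜ k C

  simulate-UBlocks : ∀ {X k a a′ b} → ≅[ ⁅ k ⁆ ] a a′ → (U : UBlocks X a b) → NoBlockOf k U →
    ∃ λ b′ → Σ (UBlocks X a′ b′) (λ U′ → NoBlockOf k U′ × ubLength U′ ≡ ubLength U) ×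
      ≅[ ⁅ k ⁆ ] b b′
  simulate-UBlocks r [] _ = _ , ([] , tt , refl) , r
  simulate-UBlocks r (blk i i∈X Ni B U) (i≢k , noK) with simulate-RPath (≢-sym i≢k) r B
  ... | _ , (B′ , eB) , r₁ with simulate-UBlocks r₁ U noK
  ... | _ , (U′ , noK′ , eU) , r₂ =
    _ , (blk i i∈X (N→ (≅⁅⁆⇒samePhase (≢-sym i≢k) r) Ni) B′ U′ , (i≢k , noK′) , cong₂ _+_ eB eU) ,
    r₂

  commute-right-step : ∀ c {j k a b z} → j ≢ k → step j a b → 𝓡 j b → ThreadPath k c b z →
    ∃₂ λ z′ w → ThreadPath k c a z′ × step j z′ w × 𝓡 j w × ≅[ ⁅ k ⁆ ] z w
  commute-right-step zero j≢k s Rb [] = _ , _ , [] , s , Rb , ε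
  commute-right-step (suc c) {j} {k} j≢k s Rb (cons _ refl sk κ)
    with right-comm j k j≢k (s , Rb) sk
  ... | _ , _ , sk′ , (s′ , Rb′) , r with simulate-path r κ
  ... | _ , κ′ , r′ with commute-right-step c j≢k s′ Rb′ κ′
  ... | _ , _ , κ″ , s″ , Rw , r″ = _ , _ , cons k refl sk′ κ″ , s″ , Rw , r′ ◅◅ r″

  commute-RPath : ∀ {c j k a b z} → j ≢ k → (B : RPath j a b) → ThreadPath k c b z →
    ∃₂ λ z′ w → ThreadPath k c a z′ × Σ (RPath j z′ w) (λ B′ → rpLength B′ ≡ rpLength B) ×
      ≅[ ⁅ k ⁆ ] z w
  commute-RPath {c} j≢k (last s Rb) κ with commute-right-step c j≢k s Rb κ
  ... | _ , _ , κ′ , s′ , Rw , r = _ , _ , κ′ , (last s′ Rw , refl) , r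
  commute-RPath {c} j≢k (more s Rb B) κ with commute-RPath j≢k B κ
  ... | _ , _ , κ₁ , (B₁ , e₁) , r₁ with commute-right-step c j≢k s Rb κ₁
  ... | _ , _ , κ₂ , s′ , Rb′ , r₂ with simulate-RPath (≢-sym j≢k) r₂ B₁
  ... | _ , (B₂ , e₂) , r₃ = _ , _ , κ₂ , (more s′ Rb′ B₂ , cong suc (trans e₂ e₁)) , r₁ ◅◅ r₃

  -- The k-blocks of U are absorbed into the k-path, all other blocks are commuted past it.
  pull-back : ∀ {X k m x y c} → (U : UBlocks X m x) → ThreadPath k c x y →
    ∃ λ z → ∃ λ y′ → ∃ λ c′ → ThreadPath k c′ m z ×
      Σ (UBlocks X z y′) (λ U′ → NoBlockOf k U′ × c′ + ubLength U′ ≡ ubLength U + c) ×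
      ≅[ ⁅ k ⁆ ] y y′
  pull-back {c = c} [] κ = _ , _ , c , κ , ([] , tt , +-identityʳ c) , ε
  pull-back {k = k} {c = c} (blk j j∈X Nj B U) κ with pull-back U κ
  ... | _ , _ , c₁ , κ₁ , (U₁ , noK₁ , eq₁) , r₁ with j ≟ k
  ... | yes refl =
    _ , _ , rpLength B + c₁ , RPath⇒path B refl ++ κ₁ , (U₁ , noK₁ , length-eq) , r₁
    where
    open ≡-Reasoning
    length-eq : rpLength B + c₁ + ubLength U₁ ≡ rpLength B + ubLength U + c
    length-eq = begin
      rpLength B + c₁ + ubLength U₁     ≡⟨ +-assoc (rpLength B) c₁ (ubLength U₁) ⟩
      rpLength B + (c₁ + ubLength U₁)   ≡⟨ cong (rpLength B +_) eq₁ ⟩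
      rpLength B + (ubLength U + c)     ≡⟨ sym (+-assoc (rpLength B) (ubLength U) c) ⟩
      rpLength B + ubLength U + c       ∎
  ... | no j≢k with commute-RPath j≢k B κ₁
  ... | _ , _ , κ₂ , (B₂ , eB) , r₂ with simulate-UBlocks r₂ U₁ noK₁
  ... | _ , (U₂ , noK₂ , eU) , r₃ =
    _ , _ , c₁ , κ₂ ,
    (blk j j∈X (N→ (threadPath⇒samePhase (≢-sym j≢k) κ₂) Nj) B₂ U₂ , (j≢k , noK₂) , length-eq) ,
    r₁ ◅◅ r₃
    where
    open ≡-Reasoning
    length-eq : c₁ + (rpLength B₂ + ubLength U₂) ≡ rpLength B + ubLength U + c
    length-eq = begin
      c₁ + (rpLength B₂ + ubLength U₂)  ≡⟨ cong₂ (λ b u → c₁ + (b + u)) eB eU ⟩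
      c₁ + (rpLength B + ubLength U₁)   ≡⟨ x∙yz≈y∙xz c₁ (rpLength B) (ubLength U₁) ⟩
      rpLength B + (c₁ + ubLength U₁)   ≡⟨ cong (rpLength B +_) eq₁ ⟩
      rpLength B + (ubLength U + c)     ≡⟨ sym (+-assoc (rpLength B) (ubLength U) c) ⟩
      rpLength B + ubLength U + c       ∎

  CBlocks-¬𝓡 : ∀ {X k a b} → CBlocks X a b → ¬ 𝓡 k a → ¬ 𝓡 k b
  CBlocks-¬𝓡 [] ¬Ra = ¬Ra
  CBlocks-¬𝓡 {k = k} (blk i _ _ B C) ¬Ra with i ≟ k
  ... | yes refl = CBlocks-¬𝓡 C (end-¬𝓡 (CPath-end B))
    where
    end-¬𝓡 : ∀ {b} → 𝓛 i b ⊎ 𝓝 i b → ¬ 𝓡 i b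
    end-¬𝓡 (inj₁ Lb) Rb = disjRL i _ Rb Lb
    end-¬𝓡 (inj₂ Nb) Rb = disjRN i _ Rb Nb
  ... | no i≢k = CBlocks-¬𝓡 C (λ Rb → ¬Ra (R← (CPath⇒samePhase i≢k B) Rb))

  -- An ots under T, without the 𝓝 preconditions of its two parts.
  data Blocks (a b : S) : Set where
    _⨾_ : ∀ {m} → CBlocks T a m → UBlocks T m b → Blocks a b

  blocksLength : ∀ {a b} → Blocks a b → ℕ
  blocksLength (C ⨾ U) = cbLength C + ubLength U

  -- Splittings of a k-path into blocks of k, the first one starting at a₀: it is
  -- either a cts block, or a uts block covering the whole path.
  OpenBlock : ℕ → Fin n → Rel S 0ℓ
  OpenBlock c k a₀ b =
    (∃₂ λ w m → Σ (CPath k a₀ w) λ B → Σ (CBlocks T w m) λ C → Σ (UBlocks T m b) λ U →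
      cpLength B + cbLength C + ubLength U ≡ suc c)
    ⊎ Σ (RPath k a₀ b) (λ B → rpLength B ≡ suc c)

  mutual
    threadPath⇒blocks : ∀ {k a b c} → k ∈ T → 𝓝 k a → ThreadPath k c a b →
      Σ (Blocks a b) λ bs → blocksLength bs ≡ c
    threadPath⇒blocks k∈T Na [] = [] ⨾ [] , refl
    threadPath⇒blocks k∈T Na (cons k refl s κ) with open-block k∈T s κ
    ... | inj₁ (_ , _ , B , C , U , eq) = blk k k∈T Na B C ⨾ U , eq
    ... | inj₂ (B , eq) = [] ⨾ blk k k∈T Na B [] , trans (+-identityʳ (rpLength B)) eq

    open-block : ∀ {k a₀ a₁ b c} → k ∈ T → step k a₀ a₁ → ThreadPath k c a₁ b → OpenBlock c k a₀ b
    open-block {k} {a₁ = a₁} k∈T s [] with partition k a₁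
    ... | inj₁ Ra₁ = inj₂ (last s Ra₁ , refl)
    ... | inj₂ LNa₁ = inj₁ (_ , _ , last s LNa₁ , [] , [] , refl)
    open-block {k} {a₁ = a₁} k∈T s (cons _ refl s′ κ) with partition k a₁ | open-block k∈T s′ κ
    ... | inj₁ Ra₁ | inj₁ (_ , _ , B , C , U , eq) =
      inj₁ (_ , _ , more s (inj₁ Ra₁) B , C , U , cong suc eq)
    ... | inj₁ Ra₁ | inj₂ (B , eq) = inj₂ (more s Ra₁ B , cong suc eq)
    ... | inj₂ (inj₁ La₁) | inj₁ (_ , _ , B , C , U , eq) =
      inj₁ (_ , _ , more s (inj₂ La₁) B , C , U , cong suc eq)
    ... | inj₂ (inj₁ La₁) | inj₂ (B , _) = ⊥-elim (no-L→R k (La₁ , proj₂ (RPath-head B)))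
    ... | inj₂ (inj₂ Na₁) | _ with threadPath⇒blocks k∈T Na₁ (cons k refl s′ κ)
    ...   | C ⨾ U , eq = inj₁ (_ , _ , last s (inj₂ Na₁) , C , U , cong suc eq)

  data LastBlock (k : Fin n) {a m : S} : CBlocks T a m → Set where
    no-block   : ∀ {C} → 𝓛 k a → NoBlockOfᶜ k C → LastBlock k C
    last-block : ∀ {a₀ b₀} (C₀ : CBlocks T a a₀) k∈T (Nk : 𝓝 k a₀) (K : CPath k a₀ b₀)
                 (D : CBlocks T b₀ m) → NoBlockOfᶜ k D → LastBlock k (C₀ ++ᶜ blk k k∈T Nk K D)

  lastBlock : ∀ {k a m} (C : CBlocks T a m) → 𝓛 k m → LastBlock k C
  lastBlock [] Lm = no-block Lm tt
  lastBlock {k} (blk i i∈T Ni B C) Lm with lastBlock C Lm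
  ... | last-block C₀ k∈T Nk K D noK = last-block (blk i i∈T Ni B C₀) k∈T Nk K D noK
  ... | no-block Lb noK with i ≟ k
  ...   | yes refl = last-block [] i∈T Ni B C noK
  ...   | no i≢k = no-block (L← (CPath⇒samePhase i≢k B) Lb) (i≢k , noK)

  cbLength-≤-++ : ∀ {X a b c} (C : CBlocks X a b) (D : CBlocks X b c) → cbLength D ≤ cbLength (C ++ᶜ D)
  cbLength-≤-++ [] D = ≤-refl
  cbLength-≤-++ (blk _ _ _ B C) D = ≤-trans (cbLength-≤-++ C D) (m≤n+m _ (cpLength B))

  𝓛-survives-UBlocks : ∀ {X k m x} (U : UBlocks X m x) → 𝓛 k m → NoBlockOf k U × 𝓛 k x
  𝓛-survives-UBlocks [] Lm = tt , Lm
  𝓛-survives-UBlocks {k = k} (blk i _ Ni B U) Lm with i ≟ k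
  ... | yes refl = ⊥-elim (disjLN k _ Lm Ni)
  ... | no i≢k with 𝓛-survives-UBlocks U (L→ (RPath⇒samePhase i≢k B) Lm)
  ... | noK , Lx = (i≢k , noK) , Lx

  Idle : S → Fin n → Set
  Idle e i = i ∈ T × 𝓝 i e

  IdleExcept : Fin n → S → Fin n → Set
  IdleExcept k e i = Idle e i × i ≢ k

  Idle-backwards : ∀ {i a b} → 𝓝 i a → (∀ {j} → i ≢ j → SamePhase j a b) → ∀ j → Idle b j → Idle a j
  Idle-backwards {i} Ni same j (j∈T , Nj) with i ≟ j
  ... | yes refl = j∈T , Ni
  ... | no i≢j = j∈T , N← (same i≢j) Nj

  IdleExcept-step : ∀ {k b e} → step k b e → ∀ j → IdleExcept k b j → Idle e j
  IdleExcept-step s j ((j∈T , Nj) , j≢k) = j∈T , N→ (step⇒samePhase (≢-sym j≢k) s) Nj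

  UBlocks⇒path : ∀ {k b x} (U : UBlocks T b x) → NoBlockOf k U → Path (IdleExcept k b) (ubLength U) b x
  UBlocks⇒path [] _ = []
  UBlocks⇒path (blk i i∈T Ni B U) (i≢k , noK) =
    RPath⇒path B ((i∈T , Ni) , i≢k) ++
    Path-map (λ j → map₁ (Idle-backwards Ni (λ i≢j → RPath⇒samePhase i≢j B) j)) (UBlocks⇒path U noK)

  blocks⇒path : ∀ {k b m x} (D : CBlocks T b m) → NoBlockOfᶜ k D → (U : UBlocks T m x) → NoBlockOf k U →
    Path (IdleExcept k b) (cbLength D + ubLength U) b x
  blocks⇒path [] _ U noKU = UBlocks⇒path U noKU
  blocks⇒path {k} {b} {x = x} (blk i i∈T Ni B D) (i≢k , noKD) U noKU =
    subst (λ l → Path (IdleExcept k b) l b x) (sym (+-assoc (cpLength B) (cbLength D) (ubLength U)))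
      (CPath⇒path B ((i∈T , Ni) , i≢k) ++
       Path-map (λ j → map₁ (Idle-backwards Ni (λ i≢j → CPath⇒samePhase i≢j B) j))
                (blocks⇒path D noKD U noKU))

  move-left : ∀ {Q k c b x y} → (∀ i → Q i → i ≢ k) → Path Q c b x → 𝓛 k x → step k x y →
    ∃₂ λ b′ y′ → (𝓛 k ◁ step k) b b′ × Path Q c b′ y′ × y ≅ y′
  move-left ≢k [] Lx s = _ , _ , (Lx , s) , [] , ε
  move-left {k = k} ≢k (cons i qi d π) Lx s with move-left ≢k π Lx s
  ... | _ , _ , Ls , π₁ , y≅ with left-comm k i (≢-sym (≢k i qi)) d Ls
  ... | _ , _ , Ls′ , d′ , r with simulate-path (≅[]⇒≅ r) π₁
  ... | _ , π₂ , r′ = _ , _ , Ls′ , cons i qi d′ π₂ , y≅ ◅◅ r′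

  join-last-block : ∀ {k a₀ b₀ m x y} (K : CPath k a₀ b₀) (D : CBlocks T b₀ m) → NoBlockOfᶜ k D →
    (U : UBlocks T m x) → 𝓛 k m → step k x y →
    ∃₂ λ e y′ → Σ (CPath k a₀ e) (λ K′ → cpLength K′ ≡ suc (cpLength K)) ×
      Path (Idle e) (cbLength D + ubLength U) e y′ × y ≅ y′
  join-last-block {k} K D noKD U Lm s with 𝓛-survives-UBlocks U Lm
  ... | noKU , Lx with move-left (λ _ → proj₂) (blocks⇒path D noKD U noKU) Lx s
  ... | e , _ , (Lb₀ , s′) , π , y≅ with partition k e
  ... | inj₁ Re = ⊥-elim (no-L→R k (Lb₀ , s′ , Re))
  ... | inj₂ LNe =
    e , _ , (CPath-snoc K Lb₀ s′ LNe , cpLength-snoc K Lb₀ s′ LNe) ,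
    Path-map (IdleExcept-step s′) π , y≅

  Reordered : ℕ → Rel S 0ℓ
  Reordered l e q = ∃ λ q′ → Σ (Blocks e q′) (λ bs → blocksLength bs ≡ l) × q′ ≅ q

  ReorderAt : ℕ → Set
  ReorderAt l = ∀ {e q} → Path (Idle e) l e q → Reordered l e q

  length-after-pull : ∀ c d₁ d₂ c′ u′ u → d₁ + d₂ ≡ c′ → c′ + u′ ≡ u + 1 →
    c + d₁ + (d₂ + u′) ≡ suc (c + u)
  length-after-pull c d₁ d₂ c′ u′ u refl eq = begin
    c + d₁ + (d₂ + u′)    ≡⟨ regroup c d₁ d₂ u′ ⟩
    c + (d₁ + d₂ + u′)    ≡⟨ cong (c +_) eq ⟩
    c + (u + 1)           ≡⟨ shift c u ⟩
    suc (c + u)           ∎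
    where
    open ≡-Reasoning
    regroup : ∀ c d₁ d₂ u′ → c + d₁ + (d₂ + u′) ≡ c + (d₁ + d₂ + u′)
    regroup = solve-∀
    shift : ∀ c u → c + (u + 1) ≡ suc (c + u)
    shift = solve-∀

  append-𝓝 : ∀ {k e m x y y′} → k ∈ T → (C : CBlocks T e m) (U : UBlocks T m x) →
    𝓝 k m → step k x y′ → y ≅ y′ → Reordered (suc (cbLength C + ubLength U)) e y
  append-𝓝 {k} k∈T C U Nm s y≅ with pull-back U (cons k refl s [])
  ... | _ , _ , c′ , κ , (U′ , _ , eqP) , r with threadPath⇒blocks k∈T Nm κ
  ... | C′ ⨾ U″ , eqD =
    _ , ((C ++ᶜ C′) ⨾ (U″ ++ᵘ U′) ,
         trans (cong₂ _+_ (cbLength-++ C C′) (ubLength-++ U″ U′))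
               (length-after-pull (cbLength C) (cbLength C′) (ubLength U″) c′ (ubLength U′) (ubLength U)
                                  eqD eqP)) ,
    ≅[]-sym (y≅ ◅◅ ≅[]⇒≅ r)

  length-after-join : ∀ c₀ κ κ′ d u c₂ u₂ → κ′ ≡ suc κ → c₂ + u₂ ≡ d + u →
    c₀ + (κ′ + c₂) + u₂ ≡ suc (c₀ + (κ + d) + u)
  length-after-join c₀ κ κ′ d u c₂ u₂ refl eq = begin
    c₀ + (suc κ + c₂) + u₂    ≡⟨ regroup c₀ κ c₂ u₂ ⟩
    suc (c₀ + κ + (c₂ + u₂))  ≡⟨ cong (λ v → suc (c₀ + κ + v)) eq ⟩
    suc (c₀ + κ + (d + u))    ≡⟨ cong suc (regroup′ c₀ κ d u) ⟩
    suc (c₀ + (κ + d) + u)    ∎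
    where
    open ≡-Reasoning
    regroup : ∀ c₀ κ c₂ u₂ → c₀ + (suc κ + c₂) + u₂ ≡ suc (c₀ + κ + (c₂ + u₂))
    regroup = solve-∀
    regroup′ : ∀ c₀ κ d u → c₀ + κ + (d + u) ≡ c₀ + (κ + d) + u
    regroup′ = solve-∀

  append-𝓛 : ∀ {k e m x y y′} (C : CBlocks T e m) (U : UBlocks T m x) →
    (∀ {l} → l ≤ cbLength C + ubLength U → ReorderAt l) →
    𝓝 k e → 𝓛 k m → step k x y′ → y ≅ y′ → Reordered (suc (cbLength C + ubLength U)) e y
  append-𝓛 {k} {e} C U ih Nke Lm s y≅ with lastBlock C Lm
  ... | no-block Le _ = ⊥-elim (disjLN k e Le Nke)
  ... | last-block C₀ k∈T Nk K D noKD with join-last-block K D noKD U Lm s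
  ... | _ , _ , (K′ , eK) , π , y′≅
    with ih (+-monoˡ-≤ (ubLength U) (≤-trans (m≤n+m (cbLength D) (cpLength K))
                                              (cbLength-≤-++ C₀ (blk k k∈T Nk K D)))) π
  ... | _ , (C₂ ⨾ U₂ , eq₂) , q≅ =
    _ , ((C₀ ++ᶜ blk k k∈T Nk K′ C₂) ⨾ U₂ ,
         trans (cong (_+ ubLength U₂) (cbLength-++ C₀ (blk k k∈T Nk K′ C₂)))
           (trans (length-after-join (cbLength C₀) (cpLength K) (cpLength K′) (cbLength D) (ubLength U)
                                     (cbLength C₂) (ubLength U₂) eK eq₂)
                  (cong (λ c → suc (c + ubLength U)) (sym (cbLength-++ C₀ (blk k k∈T Nk K D)))))) ,
    q≅ ◅◅ ≅[]-sym (y≅ ◅◅ y′≅)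

  reorder : ∀ l → ReorderAt l
  reorder = <-rec ReorderAt extend
    where
    extend : ∀ l → (∀ {l′} → l′ < l → ReorderAt l′) → ReorderAt l
    extend zero _ [] = _ , ([] ⨾ [] , refl) , ε
    extend (suc l) ih π with unsnoc π
    ... | _ , π′ , k , (k∈T , Nke) , s with ih ≤-refl π′
    ... | _ , (_⨾_ {m} C U , refl) , x≅ with simulate-step (≅[]-sym x≅) s
    ... | _ , s′ , y≅ with partition k m
    ... | inj₁ Rm = ⊥-elim (CBlocks-¬𝓡 C (λ Re → disjRN k _ Re Nke) Rm)
    ... | inj₂ (inj₁ Lm) = append-𝓛 C U (λ l′≤ → ih (s≤s l′≤)) Nke Lm s′ y≅
    ... | inj₂ (inj₂ Nm) = append-𝓝 k∈T C U Nm s′ y≅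

  threads : ∀ {X a b} → UBlocks X a b → Subset n
  threads [] = ⊥
  threads (blk i _ _ _ U) = ⁅ i ⁆ ∪ threads U

  UBlocks-reindex : ∀ {X a b} (U : UBlocks X a b) (Y : Subset n) →
    (∀ {j} → j ∈ X → j ∈ threads U → j ∈ Y) → UBlocks Y a b
  UBlocks-reindex [] Y _ = []
  UBlocks-reindex (blk i i∈X Ni B U) Y ⊆Y =
    blk i (⊆Y i∈X (x∈p∪q⁺ (inj₁ (x∈⁅x⁆ i)))) Ni B
      (UBlocks-reindex U Y (λ j∈X j∈U → ⊆Y j∈X (x∈p∪q⁺ (inj₂ j∈U))))

  threads-start-𝓝 : ∀ {X a b} (U : UBlocks X a b) → ∀ i → i ∈ threads U → 𝓝 i a
  threads-start-𝓝 [] i i∈ = ⊥-elim (∉⊥ i∈)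
  threads-start-𝓝 (blk j _ Nj B U) i i∈ with x∈p∪q⁻ ⁅ j ⁆ (threads U) i∈
  ... | inj₁ i∈j = subst (λ t → 𝓝 t _) (sym (x∈⁅y⁆⇒x≡y j i∈j)) Nj
  ... | inj₂ i∈U with j ≟ i
  ...   | yes refl = ⊥-elim (disjRN i _ (RPath-end B) (threads-start-𝓝 U i i∈U))
  ...   | no j≢i = N← (RPath⇒samePhase j≢i B) (threads-start-𝓝 U i i∈U)

  -- The uts part runs under T ∩ threads U: it need not start in 𝓝[ T ].
  blocks⇒OTS : ∀ {a b} → 𝓝[ T ] a → Blocks a b → OTS T a b
  blocks⇒OTS Na (C ⨾ U) =
    T , T ∩ threads U , ∪-abs-∩ T (threads U) , _ , (Na , C) ,
    (λ i i∈ → threads-start-𝓝 U i (proj₂ (x∈p∩q⁻ T (threads U) i∈))) ,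
    UBlocks-reindex U (T ∩ threads U) (λ j∈T j∈U → x∈p∩q⁺ (j∈T , j∈U))

  star⇒path : ∀ {p a b} → 𝓝[ T ] p → Star step[ T ] a b → ∃ λ l → Path (Idle p) l a b
  star⇒path Np ε = 0 , []
  star⇒path Np ((i , i∈T , s) ◅ ss) with star⇒path Np ss
  ... | l , π = suc l , cons i (i∈T , Np i i∈T) s π

  ots-up-to-≅ : ∀ {p q} → Star step[ T ] p q → 𝓝[ T ] p → ∃ λ q′ → OTS T p q′ × q′ ≅ q
  ots-up-to-≅ ss Np with star⇒path Np ss
  ... | l , π with reorder l π
  ... | q′ , (bs , _) , q′≅q = q′ , blocks⇒OTS Np bs , q′≅q

open ParallelTransactionSystem using (S; step[_]; 𝓝[_]; OTS; _≅_)
open ErrorStates using (𝓦)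

𝓦-respects-≅ : ∀ {n} {P : ParallelTransactionSystem n} (E : ErrorStates P) (i : Fin n) {a b} →
  _≅_ P a b → 𝓦 E i b → 𝓦 E i a
𝓦-respects-≅ E i ε Wb = Wb
𝓦-respects-≅ E i ((j , _ , r) ◅ rs) Wb with ErrorStates.≅-W E j i r
... | inj₁ (Wa , _) = Wa
... | inj₂ (_ , ¬Wm) = ⊥-elim (¬Wm (𝓦-respects-≅ E i rs Wb))

corollary11 : {n : ℕ} (P : ParallelTransactionSystem n) (E : ErrorStates P)
    (T : Subset n) (p q : S P) (i : Fin n) →
    Star (step[_] P T) p q → 𝓝[_] P T p → 𝓦 E i q →
    ∃ λ q′ → OTS P T p q′ × _≅_ P q′ q × 𝓦 E i q′
corollary11 P E T p q i path Np Wq with Reordering.ots-up-to-≅ P T path Np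
... | q′ , ots , q′≅q = q′ , ots , q′≅q , 𝓦-respects-≅ E i q′≅q Wq
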